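{- For all $L, R \in \Lambda^{\mathrm{rb}}$, if $L \rightsquigarrow R$, then either $\mathrm{RB}(L) \equiv \mathrm{RB}(R)$ or $\mathrm{RB}(L) \rightarrow \mathrm{RB}(R)$ by one step of $\beta$-reduction.
   Context: $\Lambda$ is the set of untyped $\lambda$-terms; $\rightarrow$ on $\Lambda$ is one-step $\beta$-reduction and $\equiv$ is syntactic identity. A context $C[\ ]$ is a $\lambda$-term with exactly one hole $[\ ]$; $C[M]$ is the result of placing $M$ in the hole (variables may be captured). For every $\lambda$-term $M$ there is a new constant symbol $\underline{M}$, called an atom; atoms have no free variables and substitution leaves an atom unchanged. Terms may be built from variables, atoms, application and abstraction, with substitution and free variables extended accordingly. For $M\in\Lambda$, $M^\bullet$ is the result of replacing each free variable $x$ of $M$ in $M$ by $\underline{x}$; $\Lambda^\bullet=\{M^\bullet\mid M\in\Lambda\}$. Write $M\ \vec N$ for $M\ N_1\cdots N_n$ with $n\ge 0$. $\Lambda^{\mathrm{rb}}$ is the smallest set such that: $\underline{M}\in\Lambda^{\mathrm{rb}}$ for every $M\in\Lambda$; $\langle C[\ ], M\rangle \in \Lambda^{\mathrm{rb}}$ for every context $C[\ ]$ and $M\in\Lambda^\bullet$; $\langle C[\ ], M\ \vec N\rangle\in\Lambda^{\mathrm{rb}}$ for every context $C[\ ]$, $M\in\Lambda^{\mathrm{rb}}$ and $\vec N\in\Lambda^\bullet$ (formal application). The reduction $\rightsquigarrow$ on $\Lambda^{\mathrm{rb}}$ is the smallest relation with: (1) $\langle C[\ ], \underline{M}\rangle \rightsquigarrow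 \underline{C[M]}$ for $M\in\Lambda$; (2) $\langle C[\ ], \lambda x.M\rangle \rightsquigarrow \langle C[\lambda x.[\ ]], M[x:=\underline{x}]\rangle$ for $\lambda x.M\in\Lambda^\bullet$; (3) $\langle C[\ ], \underline{M}\ N_0\ \vec N\rangle \rightsquigarrow \langle C[\ ], \langle M\ [\ ], N_0\rangle\ \vec N\rangle$ for $M\in\Lambda$, $N_0,\vec N\in\Lambda^\bullet$; (4) $\langle C[\ ], (\lambda x.M)\ N_0\ \vec N\rangle\rightsquigarrow\langle C[\ ], M[x:=N_0]\ \vec N\rangle$ for $\lambda x.M, N_0,\vec N\in\Lambda^\bullet$; (5) if $M,M'\in\Lambda^{\mathrm{rb}}$, $M\rightsquigarrow M'$ and $\vec N\in\Lambda^\bullet$, then $\langle C[\ ], M\ \vec N\rangle\rightsquigarrow\langle C[\ ], M'\ \vec N\rangle$. The read-back $\mathrm{RB}:\Lambda^\bullet\cup\Lambda^{\mathrm{rb}}\to\Lambda$ is defined by: $\mathrm{RB}(\langle C[\ ], M\ \vec N\rangle)\equiv C[\mathrm{RB}(M)\ \mathrm{RB}(N_1)\cdots\mathrm{RB}(N_n)]$ for $M\in\Lambda^\bullet\cup\Lambda^{\mathrm{rb}}$, $\vec N\in\Lambda^\bullet$; $\mathrm{RB}(M\ N)\equiv\mathrm{RB}(M)\ \mathrm{RB}(N)$ for $M,N\in\Lambda^\bullet$; $\mathrm{RB}(\lambda x.M)\equiv\lambda x.\mathrm{RB}(M[x:=\underline{x}])$ for $\lambda x.M\in\Lambda^\bullet$;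 $\mathrm{RB}(\underline{M})\equiv M$ for $M\in\Lambda$. -}

module Defs where

open import Data.Nat using (ℕ; zero; suc; _+_; _∸_; _<ᵇ_; _≡ᵇ_; pred)
open import Data.Bool using (if_then_else_)
open import Data.List using (List; []; _∷_; foldl; map)
open import Data.List.Relation.Unary.All using (All)
open import Data.Product using (Σ; _×_)
open import Data.Unit using (⊤)
open import Relation.Binary.PropositionalEquality using (_≡_)

-- Λ : untyped λ-terms, de Bruijn indices (so ≡ is identity up to α).

data Tm : Set where
  var : ℕ → Tm
  app : Tm → Tm → Tm
  lam : Tm → Tm

shift : ℕ → ℕ → Tm → Tm
shift d c (var i)   = if i <ᵇ c then var i else var (i + d)
shift d c (app s t) = app (shift d c s) (shift d c t)
shift d c (lam t)   = lam (shift d (suc c) t)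

substT : ℕ → Tm → Tm → Tm
substT k s (var i)   =
  if i <ᵇ k then var i else (if i ≡ᵇ k then shift k 0 s else var (pred i))
substT k s (app t u) = app (substT k s t) (substT k s u)
substT k s (lam t)   = lam (substT (suc k) s t)

infix 4 _⟶β_
data _⟶β_ : Tm → Tm → Set where
  β    : ∀ {M N} → app (lam M) N ⟶β substT 0 N M
  appˡ : ∀ {M M' N} → M ⟶β M' → app M N ⟶β app M' N
  appʳ : ∀ {M N N'} → N ⟶β N' → app M N ⟶β app M N'
  ξ    : ∀ {M M'} → M ⟶β M' → lam M ⟶β lam M'

apps : Tm → List Tm → Tm
apps = foldl app

-- Contexts with exactly one hole; plugging may capture variables.

data Ctx : Set where
  hole : Ctx
  lamC : Ctx → Ctx
  appL : Ctx → Tm → Ctx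
  appR : Tm → Ctx → Ctx

plug : Ctx → Tm → Tm
plug hole       M = M
plug (lamC C)   M = lam (plug C M)
plug (appL C N) M = app (plug C M) N
plug (appR N C) M = app N (plug C M)

_∘C_ : Ctx → Ctx → Ctx
hole       ∘C D = D
lamC C     ∘C D = lamC (C ∘C D)
appL C N   ∘C D = appL (C ∘C D) N
appR N C   ∘C D = appR N (C ∘C D)

-- Bound variables are de Bruijn indices (avar);
-- an atom `atom M` carries a λ-term M whose free indices are read
-- relative to the scope at the top of the atom-term (i.e. the hole of
-- the surrounding context), so substitution leaves atoms unchanged.

data ATm : Set where
  avar : ℕ → ATm
  atom : Tm → ATm
  aapp : ATm → ATm → ATm
  alam : ATm → ATm

aapps : ATm → List ATm → ATm
aapps = foldl aapp

-- M[x := N] for the outermost bound variable at depth k (N closed)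
asubst : ℕ → ATm → ATm → ATm
asubst k N (avar i)   =
  if i <ᵇ k then avar i else (if i ≡ᵇ k then N else avar (pred i))
asubst k N (atom t)   = atom t
asubst k N (aapp s t) = aapp (asubst k N s) (asubst k N t)
asubst k N (alam t)   = alam (asubst (suc k) N t)

-- M[x := x̲] when entering the binder λx (the hole moves under λx):
-- the bound variable becomes the atom of variable 0 and the contents of
-- existing atoms are shifted by one (pure de Bruijn bookkeeping).
aopen : ℕ → ATm → ATm
aopen k (avar i)   =
  if i <ᵇ k then avar i else (if i ≡ᵇ k then atom (var 0) else avar (pred i))
aopen k (atom t)   = atom (shift 1 0 t)
aopen k (aapp s t) = aapp (aopen k s) (aopen k t)
aopen k (alam t)   = alam (aopen (suc k) t)

bullet : ℕ → Tm → ATm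
bullet d (var i)   = if i <ᵇ d then avar i else atom (var (i ∸ d))
bullet d (app s t) = aapp (bullet d s) (bullet d t)
bullet d (lam t)   = alam (bullet (suc d) t)

InΛ• : ATm → Set
InΛ• M = Σ Tm (λ N → bullet 0 N ≡ M)

-- Λ^rb (raw syntax; membership is the predicate InΛrb)

data RBTm : Set where
  atm : Tm → RBTm
  ⟨_,_⟩ : Ctx → ATm → RBTm
  ⟨_,_·_⟩ : Ctx → RBTm → List ATm → RBTm

InΛrb : RBTm → Set
InΛrb (atm M)         = ⊤
InΛrb ⟨ C , M ⟩       = InΛ• M
InΛrb ⟨ C , M · Ns ⟩  = InΛrb M × All InΛ• Ns

-- the reduction ⇝.  Rules (1) and (3) are stated both for the formal
-- application with an atom head and for the (syntactically identical)
-- Λ•-term when the atom is a variable atom.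
infix 4 _⇝_
data _⇝_ : RBTm → RBTm → Set where
  r1  : ∀ {C M} → ⟨ C , atm M · [] ⟩ ⇝ atm (plug C M)
  r1• : ∀ {C M} → ⟨ C , atom M ⟩ ⇝ atm (plug C M)
  r2  : ∀ {C M} → ⟨ C , alam M ⟩ ⇝ ⟨ C ∘C lamC hole , aopen 0 M ⟩
  r3  : ∀ {C M N₀ Ns} →
        ⟨ C , atm M · N₀ ∷ Ns ⟩ ⇝ ⟨ C , ⟨ appR M hole , N₀ ⟩ · Ns ⟩
  r3• : ∀ {C M N₀ Ns} →
        ⟨ C , aapps (atom M) (N₀ ∷ Ns) ⟩ ⇝ ⟨ C , ⟨ appR M hole , N₀ ⟩ · Ns ⟩
  r4  : ∀ {C M N₀ Ns} →
        ⟨ C , aapps (alam M) (N₀ ∷ Ns) ⟩ ⇝ ⟨ C , aapps (asubst 0 N₀ M) Ns ⟩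
  r5  : ∀ {C M M' Ns} → M ⇝ M' → ⟨ C , M · Ns ⟩ ⇝ ⟨ C , M' · Ns ⟩

-- RB on atom-terms at binder depth d (RB(λx.M) ≡ λx.RB(M[x:=x̲]) unfolded)
rbA : ℕ → ATm → Tm
rbA d (avar i)   = var i
rbA d (atom t)   = shift d 0 t
rbA d (aapp s t) = app (rbA d s) (rbA d t)
rbA d (alam t)   = lam (rbA (suc d) t)

RB : RBTm → Tm
RB (atm M)        = M
RB ⟨ C , M ⟩      = plug C (rbA 0 M)
RB ⟨ C , M · Ns ⟩ = plug C (apps (RB M) (map (rbA 0) Ns))

-- Each rule of ⇝ except (4) only moves material between the context and the
-- term being read back, so RB is unchanged; rule (4) contracts a redex that
-- RB renders as an ordinary β-redex under the context, and rule (5) lifts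
-- through the context and the spine of arguments.  Everything rests on RB
-- commuting with the de Bruijn operations aopen and asubst, which holds for
-- atom-terms without dangling bound variables, as every term of Λ• is.
module Submission where

open import Defs
open import Data.Bool using (true; false)
open import Data.Bool.Properties using (T-≡; ¬-not)
open import Data.Empty using (⊥-elim)
open import Data.List using ([]; _∷_; map)
open import Data.Nat using (ℕ; suc; _+_; _<_; _≤_; _<ᵇ_; _≡ᵇ_; z≤n; s≤s)
open import Data.Nat.Properties
open import Data.Product using (_×_; _,_)
open import Data.Sum using (_⊎_; inj₁; inj₂)
open import Data.Unit using (⊤)
open import Function using (_∘′_)
open import Function.Bundles using (Equivalence)
open import Relation.Binary.Definitions using (tri<; tri≈; tri>)
open import Relation.Binary.PropositionalEquality
open import Relation.Nullary using (yes; no)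

open Equivalence using (to; from)

<⇒<ᵇ≡true : ∀ {m n} → m < n → (m <ᵇ n) ≡ true
<⇒<ᵇ≡true m<n = to T-≡ (<⇒<ᵇ m<n)

≥⇒<ᵇ≡false : ∀ {m n} → n ≤ m → (m <ᵇ n) ≡ false
≥⇒<ᵇ≡false {m} {n} n≤m = ¬-not λ m<ᵇn → <⇒≱ (<ᵇ⇒< m n (from T-≡ m<ᵇn)) n≤m

≡ᵇ-refl : ∀ n → (n ≡ᵇ n) ≡ true
≡ᵇ-refl n = to T-≡ (≡⇒≡ᵇ n n refl)

>⇒≡ᵇ≡false : ∀ {m n} → n < m → (m ≡ᵇ n) ≡ false
>⇒≡ᵇ≡false {m} {n} n<m = ¬-not λ m≡ᵇn → >⇒≢ n<m (≡ᵇ⇒≡ m n (from T-≡ m≡ᵇn))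

shift-zero : ∀ c t → shift 0 c t ≡ t
shift-zero c (var i) with i <ᵇ c
... | true  = refl
... | false = cong var (+-identityʳ i)
shift-zero c (app s t) = cong₂ app (shift-zero c s) (shift-zero c t)
shift-zero c (lam t)   = cong lam (shift-zero (suc c) t)

shift-shift : ∀ j k {c c′} → c ≤ c′ → c′ ≤ c + k → ∀ t →
  shift j c′ (shift k c t) ≡ shift (k + j) c t
shift-shift j k {c} {c′} c≤c′ c′≤c+k (var i) with i <? c
... | yes i<c rewrite <⇒<ᵇ≡true i<c | <⇒<ᵇ≡true (<-≤-trans i<c c≤c′) = refl
... | no i≮c rewrite ≥⇒<ᵇ≡false (≮⇒≥ i≮c)
                   | ≥⇒<ᵇ≡false (≤-trans c′≤c+k (+-monoˡ-≤ k (≮⇒≥ i≮c)))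
                   = cong var (+-assoc i k j)
shift-shift j k c≤c′ c′≤c+k (app s t) =
  cong₂ app (shift-shift j k c≤c′ c′≤c+k s) (shift-shift j k c≤c′ c′≤c+k t)
shift-shift j k c≤c′ c′≤c+k (lam t) =
  cong lam (shift-shift j k (s≤s c≤c′) (s≤s c′≤c+k) t)

substT-shift : ∀ j c s t → substT (c + j) s (shift (suc j) c t) ≡ shift j c t
substT-shift j c s (var i) with i <? c
... | yes i<c rewrite <⇒<ᵇ≡true i<c | <⇒<ᵇ≡true (≤-trans i<c (m≤m+n c j)) = refl
... | no i≮c rewrite ≥⇒<ᵇ≡false (≮⇒≥ i≮c) | +-suc i j
                   | ≥⇒<ᵇ≡false (m≤n⇒m≤1+n (+-monoˡ-≤ j (≮⇒≥ i≮c)))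
                   | >⇒≡ᵇ≡false (s≤s (+-monoˡ-≤ j (≮⇒≥ i≮c)))
                   = refl
substT-shift j c s (app t u) = cong₂ app (substT-shift j c s t) (substT-shift j c s u)
substT-shift j c s (lam t)   = cong lam (substT-shift j (suc c) s t)

Closed : ℕ → ATm → Set
Closed k (avar i)   = i < k
Closed k (atom t)   = ⊤
Closed k (aapp s t) = Closed k s × Closed k t
Closed k (alam t)   = Closed (suc k) t

bullet-closed : ∀ d N → Closed d (bullet d N)
bullet-closed d (var i) with i <ᵇ d in eq
... | true  = <ᵇ⇒< i d (from T-≡ eq)
... | false = _
bullet-closed d (app s t) = bullet-closed d s , bullet-closed d t
bullet-closed d (lam t)   = bullet-closed (suc d) t

InΛ•⇒Closed : ∀ {M} → InΛ• M → Closed 0 M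
InΛ•⇒Closed (N , refl) = bullet-closed 0 N

Closed-aapps⁻ : ∀ {k} h Ns → Closed k (aapps h Ns) → Closed k h
Closed-aapps⁻ h []       c = c
Closed-aapps⁻ h (N ∷ Ns) c with Closed-aapps⁻ (aapp h N) Ns c
... | ch , _ = ch

rbA-aapps : ∀ d h Ns → rbA d (aapps h Ns) ≡ apps (rbA d h) (map (rbA d) Ns)
rbA-aapps d h []       = refl
rbA-aapps d h (N ∷ Ns) = rbA-aapps d (aapp h N) Ns

rbA-aopen : ∀ j M → Closed (suc j) M → rbA (suc j) M ≡ rbA j (aopen j M)
rbA-aopen j (avar i) i<1+j with <-cmp i j
... | tri< i<j _ _ rewrite <⇒<ᵇ≡true i<j = refl
... | tri≈ _ refl _ rewrite ≥⇒<ᵇ≡false (≤-refl {i}) | ≡ᵇ-refl i = refl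
... | tri> _ _ j<i = ⊥-elim (<⇒≱ j<i (≤-pred i<1+j))
rbA-aopen j (atom t)   _       = sym (shift-shift j 1 z≤n z≤n t)
rbA-aopen j (aapp s t) (cs , ct) = cong₂ app (rbA-aopen j s cs) (rbA-aopen j t ct)
rbA-aopen j (alam t)   ct      = cong lam (rbA-aopen (suc j) t ct)

rbA-shift : ∀ k j N → Closed k N → shift j k (rbA k N) ≡ rbA (k + j) N
rbA-shift k j (avar i)   i<k     rewrite <⇒<ᵇ≡true i<k = refl
rbA-shift k j (atom t)   _       = shift-shift j k z≤n ≤-refl t
rbA-shift k j (aapp s t) (cs , ct) = cong₂ app (rbA-shift k j s cs) (rbA-shift k j t ct)
rbA-shift k j (alam t)   ct      = cong lam (rbA-shift (suc k) j t ct)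

rbA-asubst : ∀ j N M → Closed 0 N → Closed (suc j) M →
  substT j (rbA 0 N) (rbA (suc j) M) ≡ rbA j (asubst j N M)
rbA-asubst j N (avar i) cN i<1+j with <-cmp i j
... | tri< i<j _ _ rewrite <⇒<ᵇ≡true i<j = refl
... | tri≈ _ refl _ rewrite ≥⇒<ᵇ≡false (≤-refl {i}) | ≡ᵇ-refl i = rbA-shift 0 i N cN
... | tri> _ _ j<i = ⊥-elim (<⇒≱ j<i (≤-pred i<1+j))
rbA-asubst j N (atom t)   cN _       = substT-shift j 0 (rbA 0 N) t
rbA-asubst j N (aapp s t) cN (cs , ct) =
  cong₂ app (rbA-asubst j N s cN cs) (rbA-asubst j N t cN ct)
rbA-asubst j N (alam t)   cN ct      = cong lam (rbA-asubst (suc j) N t cN ct)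

rbA-β : ∀ M N → Closed 0 (aapp (alam M) N) →
  rbA 0 (aapp (alam M) N) ⟶β rbA 0 (asubst 0 N M)
rbA-β M N (cM , cN) = subst (rbA 0 (aapp (alam M) N) ⟶β_) (rbA-asubst 0 N M cN cM) β

apps-⟶β : ∀ {M M′} Ns → M ⟶β M′ → apps M Ns ⟶β apps M′ Ns
apps-⟶β []       s = s
apps-⟶β (N ∷ Ns) s = apps-⟶β Ns (appˡ s)

plug-⟶β : ∀ C {M M′} → M ⟶β M′ → plug C M ⟶β plug C M′
plug-⟶β hole       s = s
plug-⟶β (lamC C)   s = ξ (plug-⟶β C s)
plug-⟶β (appL C N) s = appˡ (plug-⟶β C s)
plug-⟶β (appR N C) s = appʳ (plug-⟶β C s)

rbA-aapps-⟶β : ∀ {h h′} Ns → rbA 0 h ⟶β rbA 0 h′ →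
  rbA 0 (aapps h Ns) ⟶β rbA 0 (aapps h′ Ns)
rbA-aapps-⟶β {h} {h′} Ns s =
  subst₂ _⟶β_ (sym (rbA-aapps 0 h Ns)) (sym (rbA-aapps 0 h′ Ns)) (apps-⟶β (map (rbA 0) Ns) s)

plug-∘C : ∀ C D t → plug (C ∘C D) t ≡ plug C (plug D t)
plug-∘C hole       D t = refl
plug-∘C (lamC C)   D t = cong lam (plug-∘C C D t)
plug-∘C (appL C N) D t = cong (λ x → app x N) (plug-∘C C D t)
plug-∘C (appR N C) D t = cong (app N) (plug-∘C C D t)

proposition2 : (L R : RBTm) → InΛrb L → InΛrb R → L ⇝ R →
    RB L ≡ RB R ⊎ RB L ⟶β RB R
proposition2 _ _ _ _ r1 = inj₁ refl
proposition2 _ _ _ _ (r1• {C} {M}) = inj₁ (cong (plug C) (shift-zero 0 M))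
proposition2 _ _ hL _ (r2 {C} {M}) = inj₁ (begin
  plug C (lam (rbA 1 M))             ≡⟨ cong (plug C ∘′ lam) (rbA-aopen 0 M (InΛ•⇒Closed hL)) ⟩
  plug C (lam (rbA 0 (aopen 0 M)))   ≡⟨ plug-∘C C (lamC hole) _ ⟨
  plug (C ∘C lamC hole) (rbA 0 (aopen 0 M)) ∎)
  where open ≡-Reasoning
proposition2 _ _ _ _ r3 = inj₁ refl
proposition2 _ _ _ _ (r3• {C} {M} {N₀} {Ns}) = inj₁ (cong (plug C) (begin
  rbA 0 (aapps (atom M) (N₀ ∷ Ns))                            ≡⟨ rbA-aapps 0 (aapp (atom M) N₀) Ns ⟩
  apps (app (shift 0 0 M) (rbA 0 N₀)) (map (rbA 0) Ns)       ≡⟨ cong (λ x → apps (app x (rbA 0 N₀)) (map (rbA 0) Ns)) (shift-zero 0 M) ⟩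
  apps (app M (rbA 0 N₀)) (map (rbA 0) Ns)                    ∎))
  where open ≡-Reasoning
proposition2 _ _ hL _ (r4 {C} {M} {N₀} {Ns}) =
  inj₂ (plug-⟶β C (rbA-aapps-⟶β Ns (rbA-β M N₀ (Closed-aapps⁻ _ Ns (InΛ•⇒Closed hL)))))
proposition2 _ _ (hM , _) (hM′ , _) (r5 {C} {M} {M′} {Ns} s) with proposition2 M M′ hM hM′ s
... | inj₁ eq = inj₁ (cong (λ x → plug C (apps x (map (rbA 0) Ns))) eq)
... | inj₂ st = inj₂ (plug-⟶β C (apps-⟶β (map (rbA 0) Ns) st))
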